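{- Let $\sigma,k\ge2$, $\rho\in\mathbb{U}_{\sigma,k}$, $i\in[1..|\rho|]$, and write $\rho[i]=u=va$ with $a\in\Sigma$ (so $|v|=k-1$). Then (i) $\mathcal{P}_{\rho,i}=u\Sigma^*\cap\mathcal{L}_{\rho,i-1}$ and $\mathcal{S}_{\rho,i}=(\mathcal{L}_{\rho,i}\cap\Sigma^*v)a$; in particular $\mathcal{P}_{\rho,i}$ and $\mathcal{S}_{\rho,i}$ are regular languages; (ii) for every $n$, $C_{\mathcal{P}_{\rho,i}}(n)$ equals the number of walks of length $n-k$ in $\mathcal{A}_{\rho,i-1}$ starting at the vertex $\lambda.u$; (iii) for every $n$, $C_{\mathcal{S}_{\rho,i}}(n)$ equals the number of walks of length $n-1$ in $\mathcal{A}_{\rho,i}$ from the vertex $\lambda$ to the vertex $v$.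
   Context: $\Sigma=\{0,\dots,\sigma-1\}$; a $k$-mer is a string of length $k$. A string $s$ avoids $t$ if $t$ is not a substring of $s$. An arrangement of $\Sigma^k$ is a sequence $\rho$ of distinct $k$-mers (its domain $U$ is the set of them); $\rho[j]$ has rank $j$. $U$ is a universal hitting set for $w$ if every string of length $w+k-1$ contains a $k$-mer of $U$; $\mathbb{U}_{\sigma,k}$ is the set of arrangements whose domain is a universal hitting set for some $w$. For $j\in[1..|\rho|]$, $\mathcal{L}_{\rho,j}$ is the set of all strings over $\Sigma$ avoiding each of $\rho[1],\dots,\rho[j]$, and $\mathcal{L}_{\rho,0}=\Sigma^*$. $\mathcal{P}_{\rho,j}$ is the set of strings $s$ with $|s|\ge k$ whose length-$k$ prefix is $\rho[j]$ and which avoid $\rho[1],\dots,\rho[j-1]$ (windows prefix-charged due to $\rho[j]$); $\mathcal{S}_{\rho,j}$ is the set of strings $s$ with $|s|\ge k$ whose length-$k$ suffix is $\rho[j]$, which contain no other occurrence of $\rho[j]$, and which avoid $\rho[1],\dots,\rho[j-1]$ (suffix-charged windows). For a language $L$, $C_L(n)=|L\cap\Sigma^n|$. Canonical DFA: for a finite nonempty set $M$ of $k$-mers, the DFA $\mathcal{A}_M$ accepting the strings avoiding all elements of $M$ is built as follows: take the trie of $M$ and name each vertex by the label of the path from the root to it (the root is the empty string $\lambda$); add, for every vertex $x$ and letter $b$, the edge $x\xrightarrow{b}y$ where $y$ is the longest suffix of $xb$ that is a vertex of the trie; then delete the leaves (the elements of $M$) with their incident edges; $\lambda$ is initial and all states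 are terminal. Thus the vertices are the proper prefixes of elements of $M$, and the transition function is partial. $\mathcal{A}_{\rho,j}$ denotes the canonical DFA for $M=\{\rho[1],\dots,\rho[j]\}$; by convention $\mathcal{A}_{\rho,0}$ is the one-state DFA with state $\lambda$ and a loop for every letter. For a state $q$ and string $x$, $q.x$ is the state reached from $q$ by reading $x$. The length of a walk is its number of edges. -}

module Defs where

open import Data.Bool using (Bool; true; false; if_then_else_; not; _∧_; T)
open import Data.Nat using (ℕ; zero; suc; _+_; _∸_; _≤ᵇ_)
open import Data.Fin as F using (Fin; toℕ)
open import Data.Maybe using (Maybe; just; nothing; maybe; _>>=_)
open import Data.List using (List; []; _∷_; _++_; [_]; length; take; drop; map;
  filterᵇ; upTo; null; concatMap; lookup; allFin)
open import Data.Bool.ListAction using (all; any)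
open import Data.Nat.ListAction using (sum)
open import Data.List.Properties using (≡-dec)
open import Data.List.Relation.Unary.All using (All)
open import Data.List.Relation.Unary.Any using (Any)
open import Data.List.Relation.Unary.Unique.Propositional using (Unique)
open import Data.Product using (Σ; ∃; _×_)
open import Relation.Nullary using (does)
open import Relation.Binary.PropositionalEquality using (_≡_)

Word : ℕ → Set
Word σ = List (Fin σ)

_==W_ : ∀ {σ} → Word σ → Word σ → Bool
x ==W y = does (≡-dec F._≟_ x y)

isPrefixB : ∀ {σ} → Word σ → Word σ → Bool
isPrefixB t s = take (length t) s ==W t

occursAt : ∀ {σ} → Word σ → Word σ → ℕ → Bool
occursAt t s p = isPrefixB t (drop p s)

isInfixB : ∀ {σ} → Word σ → Word σ → Bool
isInfixB t s = any (occursAt t s) (upTo (suc (length s)))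

avoids : ∀ {σ} → Word σ → Word σ → Bool
avoids t s = not (isInfixB t s)

-- Arrangements (ranks are 1-based in the paper; ρ[j] = lookup ρ (j-1))

IsArrangement : (σ k : ℕ) → List (Word σ) → Set
IsArrangement σ k ρ = All (λ t → length t ≡ k) ρ × Unique ρ

IsUHS : (σ k w : ℕ) → List (Word σ) → Set
IsUHS σ k w U = (s : Word σ) → length s ≡ w + k ∸ 1 → Any (λ t → T (isInfixB t s)) U

InU : (σ k : ℕ) → List (Word σ) → Set
InU σ k ρ = IsArrangement σ k ρ × ∃ λ w → IsUHS σ k w ρ

Lang : ℕ → Set
Lang σ = Word σ → Bool

inL : ∀ {σ} → List (Word σ) → ℕ → Lang σ
inL ρ j s = all (λ t → avoids t s) (take j ρ)

-- 𝓟_{ρ,j} where j = toℕ i + 1 is the rank of ρ[j] = lookup ρ i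
inP : ∀ {σ} (k : ℕ) (ρ : List (Word σ)) → Fin (length ρ) → Lang σ
inP k ρ i s = (k ≤ᵇ length s) ∧ ((take k s ==W lookup ρ i) ∧ inL ρ (toℕ i) s)

inS : ∀ {σ} (k : ℕ) (ρ : List (Word σ)) → Fin (length ρ) → Lang σ
inS k ρ i s =
  (k ≤ᵇ length s) ∧
  ((drop (length s ∸ k) s ==W lookup ρ i) ∧
   (all (λ p → not (occursAt (lookup ρ i) s p)) (upTo (length s ∸ k)) ∧
    inL ρ (toℕ i) s))

allWords : (σ n : ℕ) → List (Word σ)
allWords σ zero = [] ∷ []
allWords σ (suc n) = concatMap (λ b → map (b ∷_) (allWords σ n)) (allFin σ)

count : ∀ {σ} → Lang σ → ℕ → ℕ
count {σ} L n = length (filterᵇ L (allWords σ n))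

record DFA (σ : ℕ) : Set where
  field
    nStates : ℕ
    start   : Fin nStates
    delta   : Fin nStates → Fin σ → Maybe (Fin nStates)
    final   : Fin nStates → Bool

runDFA : ∀ {σ} (A : DFA σ) → Fin (DFA.nStates A) → Word σ → Maybe (Fin (DFA.nStates A))
runDFA A q [] = just q
runDFA A q (b ∷ w) = DFA.delta A q b >>= λ q' → runDFA A q' w

acceptsDFA : ∀ {σ} → DFA σ → Lang σ
acceptsDFA A s = maybe (DFA.final A) false (runDFA A (DFA.start A) s)

Regular : ∀ {σ} → Lang σ → Set
Regular {σ} L = Σ (DFA σ) λ A → (s : Word σ) → acceptsDFA A s ≡ L s

-- Canonical DFA 𝓐_M (states named by strings; λ = [])

-- y is a vertex of the trie of M (a prefix of some element of M)
isVertex : ∀ {σ} → List (Word σ) → Word σ → Bool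
isVertex M y = any (isPrefixB y) M

memB : ∀ {σ} → List (Word σ) → Word σ → Bool
memB M y = any (y ==W_) M

longestSuffixIn : ∀ {σ} → (Word σ → Bool) → Word σ → Word σ
longestSuffixIn P [] = []
longestSuffixIn P (c ∷ w) = if P (c ∷ w) then c ∷ w else longestSuffixIn P w

canonDelta : ∀ {σ} → List (Word σ) → Word σ → Fin σ → Maybe (Word σ)
canonDelta [] x b = just []
canonDelta (m ∷ M) x b =
  let y = longestSuffixIn (isVertex (m ∷ M)) (x ++ [ b ]) in
  if memB (m ∷ M) y then nothing else just y

deltaA : ∀ {σ} → List (Word σ) → ℕ → Word σ → Fin σ → Maybe (Word σ)
deltaA ρ j = canonDelta (take j ρ)

run : ∀ {σ} → (Word σ → Fin σ → Maybe (Word σ)) → Word σ → Word σ → Maybe (Word σ)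
run δ q [] = just q
run δ q (b ∷ w) = δ q b >>= λ q' → run δ q' w

walksFrom : ∀ {σ} → (Word σ → Fin σ → Maybe (Word σ)) → ℕ → Word σ → ℕ
walksFrom δ zero q = 1
walksFrom {σ} δ (suc n) q = sum (map (λ b → maybe (walksFrom δ n) 0 (δ q b)) (allFin σ))

walksFromTo : ∀ {σ} → (Word σ → Fin σ → Maybe (Word σ)) → ℕ → Word σ → Word σ → ℕ
walksFromTo δ zero q r = if q ==W r then 1 else 0
walksFromTo {σ} δ (suc n) q r =
  sum (map (λ b → maybe (λ q' → walksFromTo δ n q' r) 0 (δ q b)) (allFin σ))

-- Let M be a set of k-mers. Run on a word w, the canonical automaton 𝓐_M is defined exactly
-- when w avoids M, and then it is in the state λ.w = the longest suffix of w that is a proper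
-- prefix of an element of M. This invariant survives each letter c: longest prefix-suffixes
-- can be updated letter by letter, and an occurrence of some m ∈ M created by c is a suffix of
-- wc of the maximal length k, hence is that longest suffix itself and is detected by 𝓐_M.
-- So a prefix-charged window is u = ρ[i] followed by a word readable in 𝓐_{ρ,i-1} from λ.u,
-- and a suffix-charged window is a word leading from λ to v in 𝓐_{ρ,i}, followed by a (the
-- edge v -a-> is exactly the one that the occurrence of u deletes). Counting words letter by
-- letter then counts walks, and both decompositions give finite automata whose states are
-- trie vertices, plus the letters of u still to be read or a final accepting sink.

module Submission where

open import Defs
open import Data.Bool using (Bool; true; false; T; not; _∧_; _∨_; if_then_else_)
open import Data.Bool.Properties using (T-≡; T-not-≡; T-∧; T-∨; if-not)
open import Data.Empty using (⊥-elim)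
open import Data.Fin as F using (Fin; toℕ)
open import Data.Fin.Properties using (punchInᵢ≢i)
open import Data.Vec.Functional using (removeAt)
open import Data.Nat.ListAction using (sum)
open import Data.List using (List; []; _∷_; _++_; [_]; _∷ʳ_; length; take; drop; map; upTo; lookup;
  allFin; tabulate; concatMap; inits; tails; filterᵇ; initLast; _∷ʳ′_)
open import Data.List.Properties
open import Data.List.Membership.Propositional using (_∈_; _∉_; find)
open import Data.List.Membership.Propositional.Properties
  using (∈-concatMap⁺; ∈-map⁺; ∈-lookup; ∈-++⁺ˡ; ∈-++⁺ʳ)
open import Data.List.Relation.Unary.Any.Properties using (lookup-index)
open import Data.List.Relation.Unary.All as All using (All; []; _∷_)
import Data.List.Relation.Unary.All.Properties as AllP
import Data.List.Relation.Unary.Any.Properties as AnyP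
open import Data.List.Relation.Unary.Any as Any using (Any; here; there)
open import Data.List.Relation.Unary.Unique.Propositional using (Unique)
open import Data.List.Relation.Unary.AllPairs using (_∷_)
open import Data.Bool.ListAction using (all; any; or)
open import Data.Maybe using (Maybe; just; nothing; maybe; maybe′; _>>=_)
open import Data.Maybe.Properties using (just-injective)
import Data.Maybe as Maybe
open import Data.Nat using (ℕ; zero; suc; _+_; _∸_; _≤_; _<_; _≤ᵇ_; z≤n; s≤s; s≤s⁻¹)
open import Data.Nat.Properties hiding (_≟_)
open import Algebra.Properties.CommutativeMonoid.Sum +-0-commutativeMonoid
  using (sum-syntax; sum-remove; sum-cong-≗; sum-replicate-zero; ∑-comm)
open import Data.Product using (∃; ∃₂; _×_; _,_; proj₁; proj₂; map₁; map₂)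
open import Data.Sum using (_⊎_; inj₁; inj₂)
import Data.Sum as Sum
import Data.Sum.Properties as SumP
open import Data.Unit using (⊤; tt)
import Data.Unit.Properties as Unit
open import Function using (_∘_; _⇔_; mk⇔; Equivalence)
open import Relation.Nullary using (¬_; Dec; does; yes; no; contradiction)
open import Relation.Nullary.Decidable using (map′; T?)
open import Relation.Binary.PropositionalEquality hiding ([_])
open import Relation.Binary using (DecidableEquality)

open Equivalence using (to; from)

-- Factors of words

module _ {X : Set} where

  Prefix : List X → List X → Set
  Prefix t s = ∃ λ r → s ≡ t ++ r

  Suffix : List X → List X → Set
  Suffix t s = ∃ λ l → s ≡ l ++ t

  Infix : List X → List X → Set
  Infix t s = ∃₂ λ l r → s ≡ l ++ t ++ r

  prefix⇒infix : ∀ {t s} → Prefix t s → Infix t s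
  prefix⇒infix (r , eq) = [] , r , eq

  suffix⇒infix : ∀ {t s} → Suffix t s → Infix t s
  suffix⇒infix {t} (l , refl) = l , [] , cong (l ++_) (sym (++-identityʳ t))

  infix-trans : ∀ {t s w} → Infix t s → Infix s w → Infix t w
  infix-trans {t} (l , r , refl) (l′ , r′ , refl) = l′ ++ l , r ++ r′ , (begin
    l′ ++ (l ++ t ++ r) ++ r′   ≡⟨ cong (l′ ++_) (++-assoc l (t ++ r) r′) ⟩
    l′ ++ l ++ (t ++ r) ++ r′   ≡⟨ cong (λ z → l′ ++ l ++ z) (++-assoc t r r′) ⟩
    l′ ++ l ++ t ++ r ++ r′     ≡⟨ ++-assoc l′ l _ ⟨
    (l′ ++ l) ++ t ++ r ++ r′   ∎)
    where open ≡-Reasoning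

  infix-length-≤ : ∀ {t s} → Infix t s → length t ≤ length s
  infix-length-≤ {t} (l , r , refl) = ≤-trans (length-++-≤ˡ t) (length-++-≤ʳ (t ++ r) {l})

  infix-length-≡ : ∀ {t s} → Infix t s → length t ≡ length s → t ≡ s
  infix-length-≡ {t} ([] , [] , refl) _ = sym (++-identityʳ t)
  infix-length-≡ {t} ([] , c ∷ r , refl) eq =
    contradiction eq (<⇒≢ (≤-trans (s≤s (length-++-≤ˡ t)) (≤-reflexive (sym (length-++-sucʳ t c r)))))
  infix-length-≡ (c ∷ l , r , refl) eq = contradiction eq (<⇒≢ (s≤s (infix-length-≤ (l , r , refl))))

  occurrence-∷ʳ : ∀ {w c} l t z → w ∷ʳ c ≡ l ++ t ++ z → z ≡ [] ⊎ ∃ λ (z′ : List X) → w ≡ l ++ t ++ z′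
  occurrence-∷ʳ {w} {c} l t z eq with initLast z
  ... | []       = inj₁ refl
  ... | z′ ∷ʳ′ d = inj₂ (z′ , ∷ʳ-injectiveˡ w (l ++ t ++ z′) (begin
    w ∷ʳ c                    ≡⟨ eq ⟩
    l ++ t ++ z′ ∷ʳ d         ≡⟨ cong (l ++_) (++-assoc t z′ [ d ]) ⟨
    l ++ (t ++ z′) ∷ʳ d       ≡⟨ ++-assoc l (t ++ z′) [ d ] ⟨
    (l ++ t ++ z′) ∷ʳ d       ∎))
    where open ≡-Reasoning

  infix-∷ʳ : ∀ {t w c} → Infix t (w ∷ʳ c) → Infix t w ⊎ Suffix t (w ∷ʳ c)
  infix-∷ʳ {t} {w} {c} (l , z , eq) with occurrence-∷ʳ {w} {c} l t z eq
  ... | inj₁ refl        = inj₂ (l , trans eq (cong (l ++_) (++-identityʳ t)))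
  ... | inj₂ (z′ , eq′) = inj₁ (l , z′ , eq′)

  infix-∷⁻ : ∀ {t c s} → Infix t (c ∷ s) → Prefix t (c ∷ s) ⊎ Infix t s
  infix-∷⁻ ([] , r , eq)    = inj₁ (r , eq)
  infix-∷⁻ (_ ∷ l , r , eq) = inj₂ (l , r , ∷-injectiveʳ eq)

  infix-∷⁺ : ∀ {t c s} → Infix t s → Infix t (c ∷ s)
  infix-∷⁺ {c = c} (l , r , refl) = c ∷ l , r , refl

  suffix-refl : ∀ {s} → Suffix s s
  suffix-refl = [] , refl

  suffix-trans : ∀ {x y z} → Suffix x y → Suffix y z → Suffix x z
  suffix-trans {x} (l , refl) (l′ , refl) = l′ ++ l , sym (++-assoc l′ l x)

  suffix-length-≤ : ∀ {x s} → Suffix x s → length x ≤ length s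
  suffix-length-≤ (l , refl) = length-++-≤ʳ _ {l}

  suffix-[] : ∀ {x} → Suffix x [] → x ≡ []
  suffix-[] (l , eq) = ++-conicalʳ l _ (sym eq)

  suffix-∷ : ∀ {x c w} → Suffix x (c ∷ w) → x ≡ c ∷ w ⊎ Suffix x w
  suffix-∷ ([] , eq) = inj₁ (sym eq)
  suffix-∷ (_ ∷ l , eq) = inj₂ (l , ∷-injectiveʳ eq)

  suffix-∷ʳ : ∀ {x y} c → Suffix x y → Suffix (x ∷ʳ c) (y ∷ʳ c)
  suffix-∷ʳ {x} c (l , refl) = l , ++-assoc l x [ c ]

  suffix-∷ʳ⁻ : ∀ {y s c} → Suffix y (s ∷ʳ c) → y ≡ [] ⊎ ∃ λ y′ → y ≡ y′ ∷ʳ c × Suffix y′ s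
  suffix-∷ʳ⁻ {y} {s} (l , eq) with initLast y
  ... | [] = inj₁ refl
  ... | y′ ∷ʳ′ d with ∷ʳ-injective s (l ++ y′) (trans eq (sym (++-assoc l y′ [ d ])))
  ...   | s≡ly′ , refl = inj₂ (y′ , refl , l , s≡ly′)

  suffix-comparable : ∀ {x y s} → Suffix x s → Suffix y s → length x ≤ length y → Suffix x y
  suffix-comparable {y = y} {s = []} x⊒s _ _ rewrite suffix-[] x⊒s = y , sym (++-identityʳ y)
  suffix-comparable {s = c ∷ s} x⊒ y⊒ |x|≤|y| with suffix-∷ x⊒ | suffix-∷ y⊒
  ... | _         | inj₁ refl = x⊒
  ... | inj₁ refl | inj₂ y⊒s  = contradiction (≤-trans |x|≤|y| (suffix-length-≤ y⊒s)) (<-irrefl refl)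
  ... | inj₂ x⊒s  | inj₂ y⊒s  = suffix-comparable x⊒s y⊒s |x|≤|y|

  suffix-unique : ∀ {x y s} → Suffix x s → Suffix y s → length x ≡ length y → x ≡ y
  suffix-unique {x} x⊒s y⊒s eq with suffix-comparable x⊒s y⊒s (≤-reflexive eq)
  ... | [] , refl    = refl
  ... | _ ∷ d , refl = contradiction eq (<⇒≢ (s≤s (length-++-≤ʳ x {d})))

  prefix∈inits : ∀ {y m : List X} → Prefix y m → y ∈ inits m
  prefix∈inits {[]}    _        = here refl
  prefix∈inits {c ∷ y} (r , refl) = there (∈-map⁺ (c ∷_) (prefix∈inits (r , refl)))

  tails-∷ : ∀ {c : X} {r} u → c ∷ r ∈ tails u → r ∈ tails u
  tails-∷ (_ ∷ u) (here refl) = there (here refl)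
  tails-∷ (_ ∷ u) (there r∈)  = there (tails-∷ u r∈)

  lookup∉take : ∀ {xs : List X} → Unique xs → ∀ i → lookup xs i ∉ take (toℕ i) xs
  lookup∉take {_ ∷ _}  _            F.zero    ()
  lookup∉take {_ ∷ xs} (x≢ ∷ _)     (F.suc i) (here eq) = All.lookup x≢ (∈-lookup i) (sym eq)
  lookup∉take {_ ∷ xs} (_ ∷ unique) (F.suc i) (there p) = lookup∉take unique i p

  take-length-++ : ∀ (t r : List X) → take (length t) (t ++ r) ≡ t
  take-length-++ []      r = refl
  take-length-++ (c ∷ t) r = cong (c ∷_) (take-length-++ t r)

  drop-length-++ : ∀ (t r : List X) → drop (length t) (t ++ r) ≡ r
  drop-length-++ []      r = refl
  drop-length-++ (c ∷ t) r = drop-length-++ t r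

-- Boolean reflection

T⇔T⇒≡ : ∀ {a b} → T a ⇔ T b → a ≡ b
T⇔T⇒≡ {false} {false} _ = refl
T⇔T⇒≡ {false} {true}  e = ⊥-elim (from e tt)
T⇔T⇒≡ {true}  {false} e = ⊥-elim (to e tt)
T⇔T⇒≡ {true}  {true}  _ = refl

T-not : ∀ {b} → T (not b) ⇔ (¬ T b)
T-not {false} = mk⇔ (λ _ ()) (λ _ → tt)
T-not {true}  = mk⇔ (λ ()) (λ ¬tt → ¬tt tt)

¬T⇒≡false : ∀ {b} → ¬ T b → b ≡ false
¬T⇒≡false = to T-not-≡ ∘ from T-not

T-all-not : ∀ {A : Set} (f : A → Bool) xs → T (all (λ x → not (f x)) xs) ⇔ (¬ T (any f xs))
T-all-not f xs = mk⇔
  (λ all-not any-f → AllP.All¬⇒¬Any (All.map (to T-not) (AllP.all⁺ _ xs all-not)) (AnyP.any⁻ f xs any-f))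
  (λ ¬any → AllP.all⁻ _ (All.map (from T-not) (AllP.¬Any⇒All¬ xs (¬any ∘ AnyP.any⁺ f))))

T-does : ∀ {P : Set} (P? : Dec P) → T (does P?) ⇔ P
T-does (yes p) = mk⇔ (λ _ → p) (λ _ → tt)
T-does (no ¬p) = mk⇔ (λ ()) ¬p

module _ {σ : ℕ} where

  T-==W : ∀ {x y : Word σ} → T (x ==W y) ⇔ x ≡ y
  T-==W {x} {y} = T-does (≡-dec F._≟_ x y)

  T-maybe-==W : ∀ {r} (m : Maybe (Word σ)) → T (maybe′ (_==W r) false m) ⇔ m ≡ just r
  T-maybe-==W nothing  = mk⇔ (λ ()) (λ ())
  T-maybe-==W (just x) = mk⇔ (cong just ∘ to T-==W) (from T-==W ∘ just-injective)

  T-isPrefixB : ∀ {t s : Word σ} → T (isPrefixB t s) ⇔ Prefix t s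
  T-isPrefixB {t} {s} = mk⇔
    (λ h → drop (length t) s , trans (sym (take++drop≡id (length t) s))
                                      (cong (_++ drop (length t) s) (to (T-==W {x = take (length t) s}) h)))
    (λ { (r , refl) → from (T-==W {x = take (length t) (t ++ r)}) (take-length-++ t r) })

  any-occursAt-∷ : ∀ (t : Word σ) c s n →
    any (occursAt t (c ∷ s)) (upTo (suc n)) ≡ isPrefixB t (c ∷ s) ∨ any (occursAt t s) (upTo n)
  any-occursAt-∷ t c s n = cong (λ bs → isPrefixB t (c ∷ s) ∨ or bs)
    (trans (map-applyUpTo suc (occursAt t (c ∷ s)) n) (sym (map-upTo (occursAt t s) n)))

  T-isInfixB : ∀ {t s : Word σ} → T (isInfixB t s) ⇔ Infix t s
  T-isInfixB {t} {[]} = mk⇔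
    (λ h → prefix⇒infix (to T-isPrefixB (Sum.[ (λ p → p) , (λ ()) ] (to (T-∨ {isPrefixB t []}) h))))
    (λ { ([] , r , eq) → from T-∨ (inj₁ (from T-isPrefixB (r , eq))) ; (_ ∷ _ , _ , ()) })
  T-isInfixB {t} {c ∷ s} = mk⇔
    (λ h → Sum.[ prefix⇒infix ∘ to here⇔ , infix-∷⁺ ∘ to later⇔ ] (to T-∨ (subst T split h)))
    (λ i → subst T (sym split) (from T-∨ (Sum.map (from here⇔) (from later⇔) (infix-∷⁻ i))))
    where
    split = any-occursAt-∷ t c s (suc (length s))
    here⇔ = T-isPrefixB {t} {c ∷ s}
    later⇔ = T-isInfixB {t} {s}

  OccurrenceBefore : Word σ → Word σ → ℕ → Set
  OccurrenceBefore t s n = ∃₂ λ l z → s ≡ l ++ t ++ z × length l < n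

  T-any-occursAt : ∀ (t : Word σ) r y →
    T (any (occursAt t (r ++ y)) (upTo (length r))) ⇔ OccurrenceBefore t (r ++ y) (length r)
  T-any-occursAt t []      y = mk⇔ (λ ()) (λ { (_ , _ , _ , ()) })
  T-any-occursAt t (c ∷ r) y = mk⇔ (found ∘ to T-∨ ∘ subst T split) (subst T (sym split) ∘ from T-∨ ∘ search)
    where
    split = any-occursAt-∷ t c (r ++ y) (length r)
    later⇔ = T-any-occursAt t r y
    prefix⇔ = T-isPrefixB {t} {c ∷ r ++ y}
    Here = T (isPrefixB t (c ∷ r ++ y))
    Later = T (any (occursAt t (r ++ y)) (upTo (length r)))
    found : Here ⊎ Later → OccurrenceBefore t (c ∷ r ++ y) (suc (length r))
    found (inj₁ prefix) = let z , eq = to prefix⇔ prefix in [] , z , eq , s≤s z≤n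
    found (inj₂ later)  = let l , z , eq , l<r = to later⇔ later in c ∷ l , z , cong (c ∷_) eq , s≤s l<r
    search : OccurrenceBefore t (c ∷ r ++ y) (suc (length r)) → Here ⊎ Later
    search ([] , z , eq , _)          = inj₁ (from prefix⇔ (z , eq))
    search (_ ∷ l , z , eq , s≤s l<r) = inj₂ (from later⇔ (l , z , ∷-injectiveʳ eq , l<r))

  Avoids : List (Word σ) → Word σ → Set
  Avoids M s = All (λ m → ¬ Infix m s) M

  -- inL ρ j unfolds to avoidsAll (take j ρ).
  avoidsAll : List (Word σ) → Lang σ
  avoidsAll M s = all (λ t → avoids t s) M

  T-avoidsAll : ∀ {M s} → T (avoidsAll M s) ⇔ Avoids M s
  T-avoidsAll {M} {s} = mk⇔
    (All.map (λ h → to T-not h ∘ from T-isInfixB) ∘ AllP.all⁺ _ M)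
    (AllP.all⁻ _ ∘ All.map (λ h → from T-not (h ∘ to T-isInfixB)))

  avoids? : ∀ M w → Dec (Avoids M w)
  avoids? M w = map′ (to (T-avoidsAll {M = M} {s = w})) (from T-avoidsAll) (T? (avoidsAll M w))

  avoids-infix : ∀ {M s s′} → Infix s s′ → Avoids M s′ → Avoids M s
  avoids-infix s⊑s′ = All.map (λ ¬m⊑s′ m⊑s → ¬m⊑s′ (infix-trans m⊑s s⊑s′))

-- Longest suffixes

module _ {σ : ℕ} (P : Word σ → Bool) where

  longestSuffixIn-suffix : ∀ w → Suffix (longestSuffixIn P w) w
  longestSuffixIn-suffix []      = suffix-refl
  longestSuffixIn-suffix (c ∷ w) with P (c ∷ w)
  ... | true  = suffix-refl
  ... | false = suffix-trans (longestSuffixIn-suffix w) ([ c ] , refl)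

  longestSuffixIn-valid : ∀ w → longestSuffixIn P w ≡ [] ⊎ T (P (longestSuffixIn P w))
  longestSuffixIn-valid []      = inj₁ refl
  longestSuffixIn-valid (c ∷ w) with P (c ∷ w) in eq
  ... | true  = inj₂ (from T-≡ eq)
  ... | false = longestSuffixIn-valid w

  longestSuffixIn-longest : ∀ {y} w → Suffix y w → T (P y) → length y ≤ length (longestSuffixIn P w)
  longestSuffixIn-longest []      y⊒ _ = suffix-length-≤ y⊒
  longestSuffixIn-longest (c ∷ w) y⊒ Py with P (c ∷ w) in eq
  ... | true  = suffix-length-≤ y⊒
  ... | false with suffix-∷ y⊒
  ...   | inj₁ refl = contradiction (subst T eq Py) (λ ())
  ...   | inj₂ y⊒w  = longestSuffixIn-longest w y⊒w Py

  longestSuffixIn-unique : ∀ {z} w → Suffix z w → z ≡ [] ⊎ T (P z) →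
    (∀ {y} → Suffix y w → T (P y) → length y ≤ length z) → longestSuffixIn P w ≡ z
  longestSuffixIn-unique {z} w z⊒ z-valid maximal =
    suffix-unique (longestSuffixIn-suffix w) z⊒ (≤-antisym longest≤z z≤longest)
    where
    longest≤z : length (longestSuffixIn P w) ≤ length z
    longest≤z with longestSuffixIn-valid w
    ... | inj₁ eq = subst (λ x → length x ≤ length z) (sym eq) z≤n
    ... | inj₂ P⟨longest⟩ = maximal (longestSuffixIn-suffix w) P⟨longest⟩
    z≤longest : length z ≤ length (longestSuffixIn P w)
    z≤longest = Sum.[ (λ { refl → z≤n }) , longestSuffixIn-longest w z⊒ ] z-valid

  longestSuffixIn-∷ʳ : (∀ {y c} → T (P (y ∷ʳ c)) → T (P y)) → ∀ w c →
    longestSuffixIn P (longestSuffixIn P w ∷ʳ c) ≡ longestSuffixIn P (w ∷ʳ c)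
  longestSuffixIn-∷ʳ prefix-closed w c =
    sym (longestSuffixIn-unique (w ∷ʳ c) z⊒ (longestSuffixIn-valid (x ∷ʳ c)) maximal)
    where
    x = longestSuffixIn P w
    z = longestSuffixIn P (x ∷ʳ c)
    z⊒ : Suffix z (w ∷ʳ c)
    z⊒ = suffix-trans (longestSuffixIn-suffix (x ∷ʳ c)) (suffix-∷ʳ c (longestSuffixIn-suffix w))
    maximal : ∀ {y} → Suffix y (w ∷ʳ c) → T (P y) → length y ≤ length z
    maximal y⊒ Py with suffix-∷ʳ⁻ y⊒
    ... | inj₁ refl = z≤n
    ... | inj₂ (y′ , refl , y′⊒w) =
      let y′⊒x = suffix-comparable y′⊒w (longestSuffixIn-suffix w)
                   (longestSuffixIn-longest w y′⊒w (prefix-closed Py))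
      in longestSuffixIn-longest (x ∷ʳ c) (suffix-∷ʳ c y′⊒x) Py

  longestSuffixIn-self : ∀ {w} → T (P w) → longestSuffixIn P w ≡ w
  longestSuffixIn-self {w} Pw = longestSuffixIn-unique w suffix-refl (inj₂ Pw) (λ y⊒ _ → suffix-length-≤ y⊒)

longestSuffixIn-none : ∀ {σ} (w : Word σ) → longestSuffixIn (λ _ → false) w ≡ []
longestSuffixIn-none []      = refl
longestSuffixIn-none (_ ∷ w) = longestSuffixIn-none w

-- The canonical automaton

module _ {σ : ℕ} where

  Vertex : List (Word σ) → Word σ → Set
  Vertex M y = Any (Prefix y) M

  vertices : List (Word σ) → List (Word σ)
  vertices M = [] ∷ concatMap inits M

  longestVertexSuffix : List (Word σ) → Word σ → Word σ
  longestVertexSuffix M = longestSuffixIn (isVertex M)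

  stateAfter : List (Word σ) → Word σ → Maybe (Word σ)
  stateAfter M w = if avoidsAll M w then just (longestVertexSuffix M w) else nothing

  T-isVertex : ∀ {M y} → T (isVertex M y) ⇔ Vertex M y
  T-isVertex {M = M} =
    mk⇔ (Any.map (to T-isPrefixB) ∘ AnyP.any⁻ _ M) (AnyP.any⁺ _ ∘ Any.map (from T-isPrefixB))

  T-memB : ∀ {M y} → T (memB M y) ⇔ y ∈ M
  T-memB {M = M} = mk⇔ (Any.map (to (T-==W {σ})) ∘ AnyP.any⁻ _ M) (AnyP.any⁺ _ ∘ Any.map (from (T-==W {σ})))

  ∈⇒vertex : ∀ {M y} → y ∈ M → Vertex M y
  ∈⇒vertex = Any.map λ { refl → [] , sym (++-identityʳ _) }

  isVertex-∷ʳ : ∀ {M y c} → T (isVertex M (y ∷ʳ c)) → T (isVertex M y)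
  isVertex-∷ʳ {M} {y} {c} =
    from (T-isVertex {M = M}) ∘ Any.map (λ { (r , refl) → c ∷ r , ++-assoc y [ c ] r })
                              ∘ to (T-isVertex {M = M})

  longestVertexSuffix∈vertices : ∀ M w → longestVertexSuffix M w ∈ vertices M
  longestVertexSuffix∈vertices M w with longestSuffixIn-valid (isVertex M) w
  ... | inj₁ eq      = subst (_∈ vertices M) (sym eq) (here refl)
  ... | inj₂ vertex =
    there (∈-concatMap⁺ inits {xs = M} (Any.map prefix∈inits (to (T-isVertex {M = M}) vertex)))

  canonDelta-unfold : ∀ M x c → canonDelta M x c ≡
    (if memB M (longestVertexSuffix M (x ∷ʳ c)) then nothing else just (longestVertexSuffix M (x ∷ʳ c)))
  canonDelta-unfold []      x c = cong just (sym (longestSuffixIn-none (x ∷ʳ c)))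
  canonDelta-unfold (_ ∷ _) x c = refl

  canonDelta-vertices : ∀ M {x c y} → canonDelta M x c ≡ just y → y ∈ vertices M
  canonDelta-vertices M {x} {c} eq
    with memB M (longestVertexSuffix M (x ∷ʳ c)) | trans (sym (canonDelta-unfold M x c)) eq
  ... | false | refl = longestVertexSuffix∈vertices M (x ∷ʳ c)

  canonDelta-dead : ∀ M {x c} → x ∷ʳ c ∈ M → canonDelta M x c ≡ nothing
  canonDelta-dead M {x} {c} xc∈M = begin
    canonDelta M x c
      ≡⟨ canonDelta-unfold M x c ⟩
    (if memB M (longestVertexSuffix M (x ∷ʳ c)) then nothing else just (longestVertexSuffix M (x ∷ʳ c)))
      ≡⟨ cong (λ y → if memB M y then nothing else just y)
              (longestSuffixIn-self (isVertex M) (from (T-isVertex {M = M}) (∈⇒vertex xc∈M))) ⟩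
    (if memB M (x ∷ʳ c) then nothing else just (x ∷ʳ c))
      ≡⟨ cong (λ b → if b then nothing else just (x ∷ʳ c)) (to T-≡ (from (T-memB {M = M}) xc∈M)) ⟩
    nothing ∎
    where open ≡-Reasoning

  stateAfter-avoiding : ∀ {M w} → Avoids M w → stateAfter M w ≡ just (longestVertexSuffix M w)
  stateAfter-avoiding {M} {w} avoid =
    cong (λ b → if b then just (longestVertexSuffix M w) else nothing) (to T-≡ (from T-avoidsAll avoid))

  stateAfter-rejecting : ∀ {M w} → ¬ Avoids M w → stateAfter M w ≡ nothing
  stateAfter-rejecting {M} {w} reject =
    cong (λ b → if b then just (longestVertexSuffix M w) else nothing)
         (to T-not-≡ (from T-not (reject ∘ to T-avoidsAll)))

  stateAfter-defined : ∀ M w → maybe′ (λ _ → true) false (stateAfter M w) ≡ avoidsAll M w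
  stateAfter-defined M w with avoidsAll M w
  ... | true  = refl
  ... | false = refl

module _ {σ k : ℕ} {M : List (Word σ)} (lengths : All (λ m → length m ≡ k) M) where

  private
    δ = canonDelta M
    λ· = longestVertexSuffix M

  vertex-length-≤ : ∀ {y} → Vertex M y → length y ≤ k
  vertex-length-≤ {y} vertex with find vertex
  ... | _ , m∈M , (r , refl) = subst (length y ≤_) (All.lookup lengths m∈M) (length-++-≤ˡ y)

  vertex-length-≡ : ∀ {y} → Vertex M y → length y ≡ k → y ∈ M
  vertex-length-≡ vertex |y|≡k with find vertex
  ... | _ , m∈M , (r , refl) =
    subst (_∈ M) (sym (infix-length-≡ ([] , r , refl) (trans |y|≡k (sym (All.lookup lengths m∈M))))) m∈M

  longestVertexSuffix-length-≤ : ∀ w → length (λ· w) ≤ k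
  longestVertexSuffix-length-≤ w with longestSuffixIn-valid (isVertex M) w
  ... | inj₁ eq     = subst (λ z → length z ≤ k) (sym eq) z≤n
  ... | inj₂ vertex = vertex-length-≤ (to (T-isVertex {M = M} {y = λ· w}) vertex)

  avoids-short : ∀ {y} → length y ≤ k → y ∉ M → Avoids M y
  avoids-short {y} |y|≤k y∉M = All.tabulate λ {m} m∈M m⊑y →
    y∉M (subst (_∈ M) (infix-length-≡ m⊑y (≤-antisym (infix-length-≤ m⊑y)
      (subst (length y ≤_) (sym (All.lookup lengths m∈M)) |y|≤k))) m∈M)

  -- A new occurrence created by appending c is a suffix of length k, hence the longest vertex suffix.
  avoids-∷ʳ : ∀ {w c} → Avoids M w → λ· (w ∷ʳ c) ∉ M → Avoids M (w ∷ʳ c)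
  avoids-∷ʳ {w} {c} avoid z∉M = All.tabulate λ {m} m∈M m⊑wc →
    Sum.[ All.lookup avoid m∈M , (λ m⊒wc → z∉M (subst (_∈ M) (sym (z≡ m∈M m⊒wc)) m∈M)) ] (infix-∷ʳ m⊑wc)
    where
    z≡ : ∀ {m} → m ∈ M → Suffix m (w ∷ʳ c) → λ· (w ∷ʳ c) ≡ m
    z≡ m∈M m⊒wc = suffix-unique (longestSuffixIn-suffix (isVertex M) (w ∷ʳ c)) m⊒wc (≤-antisym
      (subst (_ ≤_) (sym (All.lookup lengths m∈M)) (longestVertexSuffix-length-≤ (w ∷ʳ c)))
      (longestSuffixIn-longest (isVertex M) (w ∷ʳ c) m⊒wc (from (T-isVertex {M = M}) (∈⇒vertex m∈M))))

  memB-longestVertexSuffix-∷ʳ : ∀ {w} c → Avoids M w → memB M (λ· (w ∷ʳ c)) ≡ not (avoidsAll M (w ∷ʳ c))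
  memB-longestVertexSuffix-∷ʳ {w} c avoid = T⇔T⇒≡ (mk⇔ member⇒rejected rejected⇒member)
    where
    member⇒rejected : T (memB M (λ· (w ∷ʳ c))) → T (not (avoidsAll M (w ∷ʳ c)))
    member⇒rejected z∈ = from T-not λ ok → All.lookup (to T-avoidsAll ok) (to (T-memB {M = M}) z∈)
      (suffix⇒infix (longestSuffixIn-suffix (isVertex M) (w ∷ʳ c)))
    rejected⇒member : T (not (avoidsAll M (w ∷ʳ c))) → T (memB M (λ· (w ∷ʳ c)))
    rejected⇒member rejected with memB M (λ· (w ∷ʳ c)) in eq
    ... | true  = tt
    ... | false =
      to T-not rejected (from T-avoidsAll (avoids-∷ʳ avoid λ z∈ → subst T eq (from (T-memB {M = M}) z∈)))

  canonDelta-step : ∀ {w} c → Avoids M w → δ (λ· w) c ≡ stateAfter M (w ∷ʳ c)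
  canonDelta-step {w} c avoid = begin
    δ (λ· w) c
      ≡⟨ canonDelta-unfold M (λ· w) c ⟩
    (if memB M (λ· (λ· w ∷ʳ c)) then nothing else just (λ· (λ· w ∷ʳ c)))
      ≡⟨ cong (λ y → if memB M y then nothing else just y)
              (longestSuffixIn-∷ʳ (isVertex M) (λ {y} {c} → isVertex-∷ʳ {M = M} {y} {c}) w c) ⟩
    (if memB M (λ· (w ∷ʳ c)) then nothing else just (λ· (w ∷ʳ c)))
      ≡⟨ cong (λ b → if b then nothing else just (λ· (w ∷ʳ c))) (memB-longestVertexSuffix-∷ʳ c avoid) ⟩
    (if not (avoidsAll M (w ∷ʳ c)) then nothing else just (λ· (w ∷ʳ c)))
      ≡⟨ if-not (avoidsAll M (w ∷ʳ c)) ⟩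
    stateAfter M (w ∷ʳ c) ∎
    where open ≡-Reasoning

  run-canonDelta-from : ∀ {w} → Avoids M w → ∀ y → run δ (λ· w) y ≡ stateAfter M (w ++ y)
  run-canonDelta-from {w} avoid [] =
    sym (trans (cong (stateAfter M) (++-identityʳ w)) (stateAfter-avoiding avoid))
  run-canonDelta-from {w} avoid (c ∷ y) with avoids? M (w ∷ʳ c)
  ... | yes avoid′ = begin
    run δ (λ· w) (c ∷ y)
      ≡⟨ cong (_>>= λ q → run δ q y) (trans (canonDelta-step c avoid) (stateAfter-avoiding avoid′)) ⟩
    run δ (λ· (w ∷ʳ c)) y
      ≡⟨ run-canonDelta-from avoid′ y ⟩
    stateAfter M (w ∷ʳ c ++ y)
      ≡⟨ cong (stateAfter M) (∷ʳ-++ w c y) ⟩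
    stateAfter M (w ++ c ∷ y) ∎
    where open ≡-Reasoning
  ... | no reject = begin
    run δ (λ· w) (c ∷ y)
      ≡⟨ cong (_>>= λ q → run δ q y) (trans (canonDelta-step c avoid) (stateAfter-rejecting reject)) ⟩
    nothing
      ≡⟨ stateAfter-rejecting (reject ∘ avoids-infix (prefix⇒infix (y , sym (∷ʳ-++ w c y)))) ⟨
    stateAfter M (w ++ c ∷ y) ∎
    where open ≡-Reasoning

  run-canonDelta : 0 < k → ∀ w → run δ [] w ≡ stateAfter M w
  run-canonDelta 0<k = run-canonDelta-from (avoids-short z≤n λ []∈M → <⇒≢ 0<k (All.lookup lengths []∈M))

  longestVertexSuffix-avoiding : ∀ {w y} → Avoids M w → Suffix y w → Vertex M y → suc (length y) ≡ k →
    λ· w ≡ y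
  longestVertexSuffix-avoiding {w} {y} avoid y⊒w y-vertex 1+|y|≡k =
    longestSuffixIn-unique (isVertex M) w y⊒w (inj₂ (from (T-isVertex {M = M}) y-vertex)) shorter
    where
    shorter : ∀ {z} → Suffix z w → T (isVertex M z) → length z ≤ length y
    shorter {z} z⊒w z-vertex =
      s≤s⁻¹ (subst (length z <_) (sym 1+|y|≡k) (≤∧≢⇒< (vertex-length-≤ z-vertex′) z≢k))
      where
      z-vertex′ = to (T-isVertex {M = M} {y = z}) z-vertex
      z≢k : length z ≢ k
      z≢k |z|≡k = All.lookup avoid (vertex-length-≡ z-vertex′ |z|≡k) (suffix⇒infix z⊒w)

-- Counting words

module _ {A B : Set} (p : B → Bool) where

  length-filterᵇ-map : ∀ (f : A → B) xs → length (filterᵇ p (map f xs)) ≡ length (filterᵇ (p ∘ f) xs)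
  length-filterᵇ-map f []       = refl
  length-filterᵇ-map f (x ∷ xs) with p (f x)
  ... | true  = cong suc (length-filterᵇ-map f xs)
  ... | false = length-filterᵇ-map f xs

  length-filterᵇ-concatMap : ∀ (f : A → List B) xs →
    length (filterᵇ p (concatMap f xs)) ≡ sum (map (λ x → length (filterᵇ p (f x))) xs)
  length-filterᵇ-concatMap f []       = refl
  length-filterᵇ-concatMap f (x ∷ xs) = begin
    length (filterᵇ p (f x ++ concatMap f xs))
      ≡⟨ cong length (filter-++ (T? ∘ p) (f x) (concatMap f xs)) ⟩
    length (filterᵇ p (f x) ++ filterᵇ p (concatMap f xs))
      ≡⟨ length-++ (filterᵇ p (f x)) ⟩
    length (filterᵇ p (f x)) + length (filterᵇ p (concatMap f xs))
      ≡⟨ cong (length (filterᵇ p (f x)) +_) (length-filterᵇ-concatMap f xs) ⟩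
    length (filterᵇ p (f x)) + sum (map (λ x → length (filterᵇ p (f x))) xs) ∎
    where open ≡-Reasoning

sum-allFin : ∀ {n} (f : Fin n → ℕ) → sum (map f (allFin n)) ≡ ∑[ i < n ] f i
sum-allFin {zero}  f = refl
sum-allFin {suc n} f = cong (f F.zero +_) (begin
  sum (map f (tabulate F.suc))       ≡⟨ cong sum (map-tabulate F.suc f) ⟩
  sum (tabulate (f ∘ F.suc))         ≡⟨ cong sum (map-tabulate (λ i → i) (f ∘ F.suc)) ⟨
  sum (map (f ∘ F.suc) (allFin n))   ≡⟨ sum-allFin (f ∘ F.suc) ⟩
  ∑[ i < n ] f (F.suc i)             ∎)
  where open ≡-Reasoning

sum-allFin-single : ∀ {n} (f : Fin n → ℕ) i → (∀ j → j ≢ i → f j ≡ 0) → sum (map f (allFin n)) ≡ f i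
sum-allFin-single {suc n} f i vanishes = begin
  sum (map f (allFin (suc n)))  ≡⟨ sum-allFin f ⟩
  ∑[ j < suc n ] f j            ≡⟨ sum-remove f ⟩
  f i + ∑[ j < n ] removeAt f i j
    ≡⟨ cong (f i +_) (trans (sum-cong-≗ λ j → vanishes _ (punchInᵢ≢i i j)) (sum-replicate-zero n)) ⟩
  f i + 0                       ≡⟨ +-identityʳ (f i) ⟩
  f i                           ∎
  where open ≡-Reasoning

sum-allFin-comm : ∀ {m n} (f : Fin m → Fin n → ℕ) →
  sum (map (λ i → sum (map (f i) (allFin n))) (allFin m)) ≡
  sum (map (λ j → sum (map (λ i → f i j) (allFin m))) (allFin n))
sum-allFin-comm {m} {n} f = begin
  sum (map (λ i → sum (map (f i) (allFin n))) (allFin m))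
    ≡⟨ sum-allFin (λ i → sum (map (f i) (allFin n))) ⟩
  ∑[ i < m ] sum (map (f i) (allFin n))
    ≡⟨ sum-cong-≗ (λ i → sum-allFin (f i)) ⟩
  ∑[ i < m ] ∑[ j < n ] f i j
    ≡⟨ ∑-comm f ⟩
  ∑[ j < n ] ∑[ i < m ] f i j
    ≡⟨ sum-cong-≗ (λ j → sum-allFin (λ i → f i j)) ⟨
  ∑[ j < n ] sum (map (λ i → f i j) (allFin m))
    ≡⟨ sum-allFin (λ j → sum (map (λ i → f i j) (allFin m))) ⟨
  sum (map (λ j → sum (map (λ i → f i j) (allFin m))) (allFin n)) ∎
  where open ≡-Reasoning

module _ {σ : ℕ} where

  count-zero : ∀ (L : Lang σ) → count L 0 ≡ (if L [] then 1 else 0)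
  count-zero L with L []
  ... | true  = refl
  ... | false = refl

  count-suc : ∀ (L : Lang σ) n → count L (suc n) ≡ sum (map (λ c → count (λ s → L (c ∷ s)) n) (allFin σ))
  count-suc L n = trans (length-filterᵇ-concatMap L _ (allFin σ))
    (cong sum (map-cong (λ c → length-filterᵇ-map L (c ∷_) (allWords σ n)) (allFin σ)))

  count-cong : ∀ {L L′ : Lang σ} n → (∀ s → length s ≡ n → L s ≡ L′ s) → count L n ≡ count L′ n
  count-cong {L} {L′} zero    L≗L′ =
    trans (count-zero L) (trans (cong (if_then 1 else 0) (L≗L′ [] refl)) (sym (count-zero L′)))
  count-cong {L} {L′} (suc n) L≗L′ = begin
    count L (suc n)
      ≡⟨ count-suc L n ⟩
    sum (map (λ c → count (λ s → L (c ∷ s)) n) (allFin σ))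
      ≡⟨ cong sum (map-cong (λ c → count-cong n λ s |s|≡n → L≗L′ (c ∷ s) (cong suc |s|≡n)) (allFin σ)) ⟩
    sum (map (λ c → count (λ s → L′ (c ∷ s)) n) (allFin σ))
      ≡⟨ count-suc L′ n ⟨
    count L′ (suc n) ∎
    where open ≡-Reasoning

  count-none : ∀ {L : Lang σ} n → (∀ s → length s ≡ n → ¬ T (L s)) → count L n ≡ 0
  count-none n none = trans (count-cong n λ s |s|≡n → ¬T⇒≡false (none s |s|≡n))
    (cong length (filter-none (T? ∘ λ _ → false) (All.universal (λ _ ()) (allWords σ n))))

  count-∷ʳ : ∀ (L : Lang σ) n → count L (suc n) ≡ sum (map (λ c → count (λ s → L (s ∷ʳ c)) n) (allFin σ))
  count-∷ʳ L zero    = trans (count-suc L 0)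
    (cong sum (map-cong (λ c → count-cong {λ s → L (c ∷ s)} {λ s → L (s ∷ʳ c)} 0 λ { [] _ → refl })
                        (allFin σ)))
  count-∷ʳ L (suc n) = begin
    count L (suc (suc n))
      ≡⟨ count-suc L (suc n) ⟩
    sum (map (λ b → count (λ s → L (b ∷ s)) (suc n)) (allFin σ))
      ≡⟨ cong sum (map-cong (λ b → count-∷ʳ (λ s → L (b ∷ s)) n) (allFin σ)) ⟩
    sum (map (λ b → sum (map (λ c → count (λ s → L (b ∷ s ∷ʳ c)) n) (allFin σ))) (allFin σ))
      ≡⟨ sum-allFin-comm (λ b c → count (λ s → L (b ∷ s ∷ʳ c)) n) ⟩
    sum (map (λ c → sum (map (λ b → count (λ s → L (b ∷ s ∷ʳ c)) n) (allFin σ))) (allFin σ))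
      ≡⟨ cong sum (map-cong (λ c → count-suc (λ s → L (s ∷ʳ c)) n) (allFin σ)) ⟨
    sum (map (λ c → count (λ s → L (s ∷ʳ c)) (suc n)) (allFin σ)) ∎
    where open ≡-Reasoning

  count-prefix : ∀ (L : Lang σ) u m → (∀ s → T (L s) → Prefix u s) →
    count L (length u + m) ≡ count (λ s → L (u ++ s)) m
  count-prefix L []      m _      = refl
  count-prefix L (c ∷ u) m prefix = begin
    count L (suc (length u + m))
      ≡⟨ count-suc L (length u + m) ⟩
    sum (map (λ b → count (λ s → L (b ∷ s)) (length u + m)) (allFin σ))
      ≡⟨ sum-allFin-single _ c (λ b b≢c → count-none (length u + m) λ s _ Lbs →
                                  b≢c (∷-injectiveˡ (proj₂ (prefix (b ∷ s) Lbs)))) ⟩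
    count (λ s → L (c ∷ s)) (length u + m)
      ≡⟨ count-prefix (λ s → L (c ∷ s)) u m (λ s Lcs → map₂ ∷-injectiveʳ (prefix _ Lcs)) ⟩
    count (λ s → L (c ∷ u ++ s)) m ∎
    where open ≡-Reasoning

  count-suffix : ∀ (L : Lang σ) a n → (∀ s → T (L s) → Suffix [ a ] s) →
    count L (suc n) ≡ count (λ s → L (s ∷ʳ a)) n
  count-suffix L a n suffix = trans (count-∷ʳ L n)
    (sum-allFin-single _ a λ b b≢a → count-none n λ s _ Lsb →
      b≢a (∷ʳ-injectiveʳ s _ (proj₂ (suffix (s ∷ʳ b) Lsb))))

  acceptsFrom : (Word σ → Fin σ → Maybe (Word σ)) → Word σ → (Word σ → Bool) → Lang σ
  acceptsFrom δ q final s = maybe final false (run δ q s)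

  -- Any W with the recursion of walksFrom / walksFromTo counts the words accepted from q.
  module _ (δ : Word σ → Fin σ → Maybe (Word σ)) (final : Word σ → Bool) (W : ℕ → Word σ → ℕ)
           (W-zero : ∀ q → W 0 q ≡ (if final q then 1 else 0))
           (W-suc : ∀ n q → W (suc n) q ≡ sum (map (λ c → maybe (W n) 0 (δ q c)) (allFin σ))) where

    walks-count : ∀ n q → W n q ≡ count (acceptsFrom δ q final) n
    walks-count zero    q = trans (W-zero q) (sym (count-zero (acceptsFrom δ q final)))
    walks-count (suc n) q = begin
      W (suc n) q
        ≡⟨ W-suc n q ⟩
      sum (map (λ c → maybe (W n) 0 (δ q c)) (allFin σ))
        ≡⟨ cong sum (map-cong first-step (allFin σ)) ⟩
      sum (map (λ c → count (λ s → acceptsFrom δ q final (c ∷ s)) n) (allFin σ))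
        ≡⟨ count-suc (acceptsFrom δ q final) n ⟨
      count (acceptsFrom δ q final) (suc n) ∎
      where
      open ≡-Reasoning
      first-step : ∀ c → maybe (W n) 0 (δ q c) ≡ count (λ s → acceptsFrom δ q final (c ∷ s)) n
      first-step c with δ q c
      ... | nothing = sym (count-none n λ _ _ ())
      ... | just q′ = walks-count n q′

  walksFrom-count : ∀ δ n q → walksFrom δ n q ≡ count (acceptsFrom δ q (λ _ → true)) n
  walksFrom-count δ = walks-count δ (λ _ → true) (walksFrom δ) (λ _ → refl) (λ _ _ → refl)

  walksFromTo-count : ∀ δ n q r → walksFromTo δ n q r ≡ count (acceptsFrom δ q (_==W r)) n
  walksFromTo-count δ n q r =
    walks-count δ (_==W r) (λ m q → walksFromTo δ m q r) (λ _ → refl) (λ _ _ → refl) n q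

-- Automata and regularity

record Automaton (σ : ℕ) : Set₁ where
  field
    State       : Set
    _≟_         : DecidableEquality State
    start       : State
    step        : State → Fin σ → Maybe State
    accepting   : State → Bool
    Valid       : State → Set
    states      : List State
    valid⇒∈     : ∀ {x} → Valid x → x ∈ states
    start-valid : Valid start
    step-valid  : ∀ {x c y} → Valid x → step x c ≡ just y → Valid y

  runFrom : State → Word σ → Maybe State
  runFrom x []      = just x
  runFrom x (c ∷ w) = step x c >>= λ y → runFrom y w

  acceptedFrom : State → Lang σ
  acceptedFrom x w = maybe accepting false (runFrom x w)

  accepts : Lang σ
  accepts = acceptedFrom start

module _ {σ : ℕ} (A : Automaton σ) where
  open Automaton A
  open import Data.List.Membership.DecPropositional _≟_ using (_∈?_)

  private
    indexOf : State → Maybe (Fin (length states))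
    indexOf y with y ∈? states
    ... | yes y∈ = just (Any.index y∈)
    ... | no  _  = nothing

    start∈ : start ∈ states
    start∈ = valid⇒∈ start-valid

    dfa : DFA σ
    dfa = record
      { nStates = length states
      ; start   = Any.index start∈
      ; delta   = λ q c → step (lookup states q) c >>= indexOf
      ; final   = accepting ∘ lookup states
      }

    runDFA-lookup : ∀ q w → Valid (lookup states q) →
      Maybe.map (lookup states) (runDFA dfa q w) ≡ runFrom (lookup states q) w
    runDFA-lookup q []      _     = refl
    runDFA-lookup q (c ∷ w) valid with step (lookup states q) c in eq
    ... | nothing = refl
    ... | just y with y ∈? states
    ...   | no  y∉ = contradiction (valid⇒∈ (step-valid valid eq)) y∉
    ...   | yes y∈ =
      trans (runDFA-lookup (Any.index y∈) w (subst Valid (lookup-index y∈) (step-valid valid eq)))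
            (cong (λ z → runFrom z w) (sym (lookup-index y∈)))

    maybe-map : ∀ m →
      maybe′ (accepting ∘ lookup states) false m ≡ maybe′ accepting false (Maybe.map (lookup states) m)
    maybe-map nothing  = refl
    maybe-map (just _) = refl

  Automaton-regular : Regular accepts
  Automaton-regular = dfa , λ w → begin
    acceptsDFA dfa w
      ≡⟨ maybe-map (runDFA dfa (Any.index start∈) w) ⟩
    maybe′ accepting false (Maybe.map (lookup states) (runDFA dfa (Any.index start∈) w))
      ≡⟨ cong (maybe′ accepting false)
              (runDFA-lookup (Any.index start∈) w (subst Valid (lookup-index start∈) start-valid)) ⟩
    maybe′ accepting false (runFrom (lookup states (Any.index start∈)) w)
      ≡⟨ cong (λ x → acceptedFrom x w) (lookup-index start∈) ⟨
    accepts w ∎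
    where open ≡-Reasoning

Regular-⇔ : ∀ {σ} {L L′ : Lang σ} → (∀ s → T (L s) ⇔ T (L′ s)) → Regular L → Regular L′
Regular-⇔ L⇔L′ (A , accepts≡L) = A , λ s → trans (accepts≡L s) (T⇔T⇒≡ (L⇔L′ s))

module _ {σ : ℕ} (M : List (Word σ)) (q : Word σ) (q∈ : q ∈ vertices M) (final : Word σ → Bool) where

  canonicalAutomaton : Automaton σ
  canonicalAutomaton = record
    { State = Word σ ; _≟_ = ≡-dec F._≟_
    ; start = q ; step = canonDelta M ; accepting = final
    ; Valid = _∈ vertices M ; states = vertices M ; valid⇒∈ = λ x∈ → x∈
    ; start-valid = q∈ ; step-valid = λ _ → canonDelta-vertices M
    }

  private
    runFrom≡run : ∀ x w → Automaton.runFrom canonicalAutomaton x w ≡ run (canonDelta M) x w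
    runFrom≡run x []      = refl
    runFrom≡run x (c ∷ w) with canonDelta M x c
    ... | nothing = refl
    ... | just y  = runFrom≡run y w

  accepts-canonical : ∀ s → Automaton.accepts canonicalAutomaton s ≡ acceptsFrom (canonDelta M) q final s
  accepts-canonical s = cong (maybe′ final false) (runFrom≡run q s)

module _ {σ : ℕ} (u : Word σ) (A : Automaton σ) where

  private
    module A = Automaton A

    -- inj₁ r: the rest r of u is still to be read; once it is exhausted, A takes over.
    State = Word σ ⊎ A.State

    enter : Word σ → State
    enter []      = inj₂ A.start
    enter (c ∷ r) = inj₁ (c ∷ r)

    step : State → Fin σ → Maybe State
    step (inj₁ [])      _ = nothing
    step (inj₁ (c ∷ r)) b = if does (b F.≟ c) then just (enter r) else nothing
    step (inj₂ x)       b = Maybe.map inj₂ (A.step x b)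

    accepting : State → Bool
    accepting (inj₁ _) = false
    accepting (inj₂ x) = A.accepting x

    Valid : State → Set
    Valid (inj₁ r) = r ∈ tails u
    Valid (inj₂ x) = A.Valid x

    states : List State
    states = map inj₁ (tails u) ++ map inj₂ A.states

    valid⇒∈ : ∀ {x} → Valid x → x ∈ states
    valid⇒∈ {inj₁ r} r∈ = ∈-++⁺ˡ (∈-map⁺ inj₁ r∈)
    valid⇒∈ {inj₂ x} x-valid = ∈-++⁺ʳ (map inj₁ (tails u)) (∈-map⁺ inj₂ (A.valid⇒∈ x-valid))

    enter-valid : ∀ {r} → r ∈ tails u → Valid (enter r)
    enter-valid {[]}    _  = A.start-valid
    enter-valid {_ ∷ _} r∈ = r∈

    step-valid : ∀ {x b y} → Valid x → step x b ≡ just y → Valid y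
    step-valid {inj₁ (c ∷ r)} {b} r∈ eq with b F.≟ c
    step-valid {inj₁ (c ∷ r)} {b} r∈ refl | yes _ = enter-valid (tails-∷ u r∈)
    step-valid {inj₂ x} {b} x-valid eq with A.step x b in eq′
    step-valid {inj₂ x} {b} x-valid refl | just _ = A.step-valid x-valid eq′

  prefixed : Automaton σ
  prefixed = record
    { State = State ; _≟_ = SumP.≡-dec (≡-dec F._≟_) A._≟_
    ; start = enter u ; step = step ; accepting = accepting
    ; Valid = Valid ; states = states ; valid⇒∈ = valid⇒∈
    ; start-valid = enter-valid (here refl) ; step-valid = λ {x} {c} → step-valid {x} {c}
    }

  private
    module P = Automaton prefixed

    accepted-inj₂ : ∀ x s → P.acceptedFrom (inj₂ x) s ≡ A.acceptedFrom x s
    accepted-inj₂ x []      = refl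
    accepted-inj₂ x (c ∷ s) with A.step x c
    ... | nothing = refl
    ... | just y  = accepted-inj₂ y s

    accepted-enter : ∀ r s → T (P.acceptedFrom (enter r) s) ⇔ (∃ λ t → s ≡ r ++ t × T (A.accepts t))
    accepted-enter []      s = mk⇔ (λ acc → s , refl , subst T (accepted-inj₂ A.start s) acc)
                                   (λ { (t , refl , acc) → subst T (sym (accepted-inj₂ A.start t)) acc })
    accepted-enter (c ∷ r) []      = mk⇔ (λ ()) (λ { (_ , () , _) })
    accepted-enter (c ∷ r) (b ∷ s) with b F.≟ c
    ... | yes refl = mk⇔ (map₂ (map₁ (cong (b ∷_))) ∘ to (accepted-enter r s))
                         (from (accepted-enter r s) ∘ map₂ (map₁ ∷-injectiveʳ))
    ... | no  b≢c  = mk⇔ (λ ()) (λ { (_ , eq , _) → b≢c (∷-injectiveˡ eq) })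

  accepts-prefixed : ∀ s → T (P.accepts s) ⇔ (∃ λ t → s ≡ u ++ t × T (A.accepts t))
  accepts-prefixed = accepted-enter u

-- Without dead, an accepting state would have to both follow its a-edge and jump to the sink.
module _ {σ : ℕ} (A : Automaton σ) (a : Fin σ)
         (dead : ∀ {x} → T (Automaton.accepting A x) → Automaton.step A x a ≡ nothing) where

  private
    module A = Automaton A

    State = A.State ⊎ ⊤

    step : State → Fin σ → Maybe State
    step (inj₁ x) b = if A.accepting x ∧ does (b F.≟ a) then just (inj₂ tt) else Maybe.map inj₁ (A.step x b)
    step (inj₂ _) _ = nothing

    accepting : State → Bool
    accepting (inj₁ _) = false
    accepting (inj₂ _) = true

    Valid : State → Set
    Valid (inj₁ x) = A.Valid x
    Valid (inj₂ _) = ⊤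

    states : List State
    states = map inj₁ A.states ++ [ inj₂ tt ]

    valid⇒∈ : ∀ {x} → Valid x → x ∈ states
    valid⇒∈ {inj₁ x} x-valid = ∈-++⁺ˡ (∈-map⁺ inj₁ (A.valid⇒∈ x-valid))
    valid⇒∈ {inj₂ _} _       = ∈-++⁺ʳ (map inj₁ A.states) (here refl)

    step-valid : ∀ {x b y} → Valid x → step x b ≡ just y → Valid y
    step-valid {inj₁ x} {b} x-valid eq with A.accepting x ∧ does (b F.≟ a)
    step-valid {inj₁ x} {b} x-valid refl | true = tt
    step-valid {inj₁ x} {b} x-valid eq   | false with A.step x b in eq′
    step-valid {inj₁ x} {b} x-valid refl | false | just _ = A.step-valid x-valid eq′

  thenLetter : Automaton σ
  thenLetter = record
    { State = State ; _≟_ = SumP.≡-dec A._≟_ Unit._≟_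
    ; start = inj₁ A.start ; step = step ; accepting = accepting
    ; Valid = Valid ; states = states ; valid⇒∈ = valid⇒∈
    ; start-valid = A.start-valid ; step-valid = λ {x} {c} → step-valid {x} {c}
    }

  private
    module S = Automaton thenLetter

    accepted⇒ : ∀ x s → T (S.acceptedFrom (inj₁ x) s) → ∃ λ t → s ≡ t ∷ʳ a × T (A.acceptedFrom x t)
    accepted⇒ x (b ∷ s) acc with A.accepting x ∧ does (b F.≟ a) in eq
    accepted⇒ x (b ∷ []) _ | true =
      let x-accepting , b≟a = to T-∧ (from T-≡ eq) in [] , cong [_] (to (T-does (b F.≟ a)) b≟a) , x-accepting
    accepted⇒ x (b ∷ s) acc | false with A.step x b in eq′
    ... | just y with accepted⇒ y s acc
    ...   | t , refl , t-acc = b ∷ t , refl ,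
            subst T (cong (λ m → maybe′ A.accepting false (m >>= λ z → A.runFrom z t)) (sym eq′)) t-acc

    accepted⇐ : ∀ x t → T (A.acceptedFrom x t) → T (S.acceptedFrom (inj₁ x) (t ∷ʳ a))
    accepted⇐ x []      x-accepting with A.accepting x | a F.≟ a
    ... | true | yes _  = tt
    ... | true | no a≢a = contradiction refl a≢a
    accepted⇐ x (b ∷ t) acc with A.step x b in eq′
    ... | just y with A.accepting x ∧ does (b F.≟ a) in eq
    ...   | false = accepted⇐ y t acc
    ...   | true  = let x-accepting , b≟a = to T-∧ (from T-≡ eq) in
                    contradiction (trans (sym eq′) (subst (λ c → A.step x c ≡ nothing)
                      (sym (to (T-does (b F.≟ a)) b≟a)) (dead x-accepting))) λ ()

  accepts-thenLetter : ∀ s → T (S.accepts s) ⇔ (∃ λ t → s ≡ t ∷ʳ a × T (A.accepts t))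
  accepts-thenLetter s = mk⇔ (accepted⇒ A.start s) λ { (t , refl , acc) → accepted⇐ A.start t acc }

-- Windows charged to ρ[i]

module Window {σ k : ℕ} (ρ : List (Word σ)) (lengths : All (λ t → length t ≡ k) ρ) (unique : Unique ρ)
              (i : Fin (length ρ)) {v : Word σ} {a : Fin σ} (u≡va : lookup ρ i ≡ v ∷ʳ a) where

  -- For the rank j = toℕ i + 1 of u = ρ[j]: ρ<i lists ρ[1..j-1] and ρ≤i lists ρ[1..j].
  u : Word σ
  u = lookup ρ i

  ρ<i : List (Word σ)
  ρ<i = take (toℕ i) ρ

  ρ≤i : List (Word σ)
  ρ≤i = take (suc (toℕ i)) ρ

  lengths<i : All (λ t → length t ≡ k) ρ<i
  lengths<i = AllP.take⁺ (toℕ i) lengths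

  lengths≤i : All (λ t → length t ≡ k) ρ≤i
  lengths≤i = AllP.take⁺ (suc (toℕ i)) lengths

  |u|≡k : length u ≡ k
  |u|≡k = All.lookup lengths (∈-lookup i)

  1+|v|≡|u| : suc (length v) ≡ length u
  1+|v|≡|u| = sym (trans (cong length u≡va) (trans (length-++ v) (+-comm (length v) 1)))

  0<k : 0 < k
  0<k = subst (0 <_) (trans 1+|v|≡|u| |u|≡k) (s≤s z≤n)

  u∉ρ<i : u ∉ ρ<i
  u∉ρ<i = lookup∉take unique i

  u∈ρ≤i : u ∈ ρ≤i
  u∈ρ≤i = subst (u ∈_) (sym (take-suc ρ i)) (∈-++⁺ʳ ρ<i (here refl))

  avoids≤i⇔ : ∀ {t} → Avoids ρ≤i t ⇔ (Avoids ρ<i t × ¬ Infix u t)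
  avoids≤i⇔ {t} = mk⇔
    (λ avoid → map₂ All.head (AllP.++⁻ ρ<i (subst (λ N → Avoids N t) (take-suc ρ i) avoid)))
    (λ { (avoid , u⋢t) → subst (λ N → Avoids N t) (sym (take-suc ρ i)) (AllP.++⁺ avoid (u⋢t ∷ [])) })

  δ<i : Word σ → Fin σ → Maybe (Word σ)
  δ<i = deltaA ρ (toℕ i)

  δ≤i : Word σ → Fin σ → Maybe (Word σ)
  δ≤i = deltaA ρ (suc (toℕ i))

  inP⇔ : ∀ s → T (inP k ρ i s) ⇔ (Prefix u s × T (inL ρ (toℕ i) s))
  inP⇔ s = mk⇔
    (λ h → let _ , h′ = to (T-∧ {k ≤ᵇ length s}) h ; u⊑s , avoid = to T-∧ h′ in to prefix⇔ u⊑s , avoid)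
    (λ { (u⊑s , avoid) → from T-∧ (≤⇒≤ᵇ (k≤ u⊑s) , from T-∧ (from prefix⇔ u⊑s , avoid)) })
    where
    prefix⇔ : T (take k s ==W u) ⇔ Prefix u s
    prefix⇔ = subst (λ n → T (take n s ==W u) ⇔ Prefix u s) |u|≡k T-isPrefixB
    k≤ : Prefix u s → k ≤ length s
    k≤ u⊑s = subst (_≤ length s) |u|≡k (infix-length-≤ (prefix⇒infix u⊑s))

  q : Word σ
  q = longestVertexSuffix ρ<i u

  u-avoids : Avoids ρ<i u
  u-avoids = avoids-short lengths<i (≤-reflexive |u|≡k) u∉ρ<i

  run-u : run δ<i [] u ≡ just q
  run-u = trans (run-canonDelta lengths<i 0<k u) (stateAfter-avoiding u-avoids)

  inP-u++ : ∀ s → inP k ρ i (u ++ s) ≡ acceptsFrom δ<i q (λ _ → true) s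
  inP-u++ s = begin
    inP k ρ i (u ++ s)
      ≡⟨ T⇔T⇒≡ (mk⇔ (proj₂ ∘ to (inP⇔ (u ++ s))) (λ avoid → from (inP⇔ (u ++ s)) ((s , refl) , avoid))) ⟩
    avoidsAll ρ<i (u ++ s)
      ≡⟨ stateAfter-defined ρ<i (u ++ s) ⟨
    maybe′ (λ _ → true) false (stateAfter ρ<i (u ++ s))
      ≡⟨ cong (maybe′ (λ _ → true) false) (run-canonDelta-from lengths<i u-avoids s) ⟨
    acceptsFrom δ<i q (λ _ → true) s ∎
    where open ≡-Reasoning

  count-P : ∀ m → count (inP k ρ i) (m + k) ≡ walksFrom δ<i m q
  count-P m = begin
    count (inP k ρ i) (m + k)
      ≡⟨ cong (count (inP k ρ i)) (trans (+-comm m k) (cong (_+ m) (sym |u|≡k))) ⟩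
    count (inP k ρ i) (length u + m)
      ≡⟨ count-prefix (inP k ρ i) u m (λ s → proj₁ ∘ to (inP⇔ s)) ⟩
    count (λ s → inP k ρ i (u ++ s)) m
      ≡⟨ count-cong m (λ s _ → inP-u++ s) ⟩
    count (acceptsFrom δ<i q (λ _ → true)) m
      ≡⟨ walksFrom-count δ<i m q ⟨
    walksFrom δ<i m q ∎
    where open ≡-Reasoning

  count-P-short : ∀ n → n < k → count (inP k ρ i) n ≡ 0
  count-P-short n n<k = count-none n λ s |s|≡n h →
    <⇒≱ n<k (subst (k ≤_) |s|≡n (≤ᵇ⇒≤ k (length s) (proj₁ (to (T-∧ {k ≤ᵇ length s}) h))))

  regular-P : Regular (inP k ρ i)
  regular-P = Regular-⇔ accepts⇔ (Automaton-regular (prefixed u A))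
    where
    A = canonicalAutomaton ρ<i q (longestVertexSuffix∈vertices ρ<i u) (λ _ → true)
    A≡ : ∀ t → Automaton.accepts A t ≡ inP k ρ i (u ++ t)
    A≡ t = trans (accepts-canonical ρ<i q _ _ t) (sym (inP-u++ t))
    accepts⇔ : ∀ s → T (Automaton.accepts (prefixed u A) s) ⇔ T (inP k ρ i s)
    accepts⇔ s = mk⇔
      (λ acc → let t , eq , t-acc = to (accepts-prefixed u A s) acc in
               subst (T ∘ inP k ρ i) (sym eq) (subst T (A≡ t) t-acc))
      (λ h → let t , eq = proj₁ (to (inP⇔ s) h) in
             from (accepts-prefixed u A s) (t , eq , subst T (sym (A≡ t)) (subst (T ∘ inP k ρ i) eq h)))

  r++u≡r++v∷ʳa : ∀ r → r ++ u ≡ (r ++ v) ∷ʳ a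
  r++u≡r++v∷ʳa r = trans (cong (r ++_) u≡va) (sym (++-assoc r v [ a ]))

  earlyOccurrence⇔infix : ∀ r → OccurrenceBefore u (r ++ u) (length r) ⇔ Infix u (r ++ v)
  earlyOccurrence⇔infix r = mk⇔ early⇒infix infix⇒early
    where
    early⇒infix : OccurrenceBefore u (r ++ u) (length r) → Infix u (r ++ v)
    early⇒infix (l , z , eq , l<r)
      with occurrence-∷ʳ {w = r ++ v} {c = a} l u z (trans (sym (r++u≡r++v∷ʳa r)) eq)
    ... | inj₂ (z′ , eq′) = l , z′ , eq′
    ... | inj₁ refl       = contradiction l<r (<-irrefl (cong length (sym r≡l)))
      where
      r≡l : r ≡ l
      r≡l = ++-cancelʳ u r l (trans eq (cong (l ++_) (++-identityʳ u)))
    infix⇒early : Infix u (r ++ v) → OccurrenceBefore u (r ++ u) (length r)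
    infix⇒early (l , z , eq) = l , z ∷ʳ a , occurrence , l<r
      where
      occurrence : r ++ u ≡ l ++ u ++ z ∷ʳ a
      occurrence = begin
        r ++ u              ≡⟨ r++u≡r++v∷ʳa r ⟩
        (r ++ v) ∷ʳ a       ≡⟨ cong (_∷ʳ a) eq ⟩
        (l ++ u ++ z) ∷ʳ a  ≡⟨ ++-assoc l (u ++ z) [ a ] ⟩
        l ++ (u ++ z) ∷ʳ a  ≡⟨ cong (l ++_) (++-assoc u z [ a ]) ⟩
        l ++ u ++ z ∷ʳ a    ∎
        where open ≡-Reasoning
      l<r : length l < length r
      l<r = +-cancelʳ-≤ (length v) (suc (length l)) (length r) (begin
        suc (length l) + length v  ≡⟨ +-suc (length l) (length v) ⟨
        length l + suc (length v)  ≡⟨ cong (length l +_) 1+|v|≡|u| ⟩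
        length l + length u        ≤⟨ +-monoʳ-≤ (length l) (length-++-≤ˡ u) ⟩
        length l + length (u ++ z) ≡⟨ length-++ l ⟨
        length (l ++ u ++ z)       ≡⟨ cong length eq ⟨
        length (r ++ v)            ≡⟨ length-++ r ⟩
        length r + length v        ∎)
        where open ≤-Reasoning

  T-noEarlyOccurrence : ∀ r →
    T (all (λ p → not (occursAt u (r ++ u) p)) (upTo (length r))) ⇔ (¬ Infix u (r ++ v))
  T-noEarlyOccurrence r = mk⇔
    (λ none u⊑ → to none⇔ none (from (T-any-occursAt u r u) (from (earlyOccurrence⇔infix r) u⊑)))
    (λ u⋢ → from none⇔ (u⋢ ∘ to (earlyOccurrence⇔infix r) ∘ to (T-any-occursAt u r u)))
    where none⇔ = T-all-not (occursAt u (r ++ u)) (upTo (length r))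

  avoids<i-r++u : ∀ r → Avoids ρ<i (r ++ v) → Avoids ρ<i (r ++ u)
  avoids<i-r++u r avoid = subst (Avoids ρ<i) (sym (r++u≡r++v∷ʳa r)) (All.tabulate λ {m} m∈ρ<i m⊑ →
    Sum.[ All.lookup avoid m∈ρ<i ,
          (λ m⊒ → u∉ρ<i (subst (_∈ ρ<i) (suffix-unique m⊒ u⊒ (|m|≡|u| m∈ρ<i)) m∈ρ<i)) ]′
        (infix-∷ʳ m⊑))
    where
    u⊒ : Suffix u ((r ++ v) ∷ʳ a)
    u⊒ = r , sym (r++u≡r++v∷ʳa r)
    |m|≡|u| : ∀ {m} → m ∈ ρ<i → length m ≡ length u
    |m|≡|u| m∈ρ<i = trans (All.lookup lengths<i m∈ρ<i) (sym |u|≡k)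

  |r++u|∸k≡|r| : ∀ r → length (r ++ u) ∸ k ≡ length r
  |r++u|∸k≡|r| r =
    trans (cong (_∸ k) (trans (length-++ r) (cong (length r +_) |u|≡k))) (m+n∸n≡m (length r) k)

  inS-r++u⇔ : ∀ r → T (inS k ρ i (r ++ u)) ⇔ (¬ Infix u (r ++ v) × Avoids ρ<i (r ++ u))
  inS-r++u⇔ r = mk⇔
    (λ h → let _ , h₁ = to (T-∧ {k ≤ᵇ length (r ++ u)}) h ; _ , h₂ = to (T-∧ {last-k==u}) h₁
               none , avoid = to (T-∧ {noEarly (length (r ++ u) ∸ k)}) h₂ in
           to (T-noEarlyOccurrence r) (subst (T ∘ noEarly) (|r++u|∸k≡|r| r) none) , to T-avoidsAll avoid)
    (λ { (u⋢ , avoid) → from T-∧ (≤⇒≤ᵇ k≤ , from T-∧ (from T-==W last-k , from T-∧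
           (subst (T ∘ noEarly) (sym (|r++u|∸k≡|r| r)) (from (T-noEarlyOccurrence r) u⋢) ,
            from T-avoidsAll avoid))) })
    where
    noEarly : ℕ → Bool
    noEarly n = all (λ p → not (occursAt u (r ++ u) p)) (upTo n)
    last-k==u = drop (length (r ++ u) ∸ k) (r ++ u) ==W u
    k≤ : k ≤ length (r ++ u)
    k≤ = subst (_≤ length (r ++ u)) |u|≡k (length-++-≤ʳ u {r})
    last-k : drop (length (r ++ u) ∸ k) (r ++ u) ≡ u
    last-k = trans (cong (λ n → drop n (r ++ u)) (|r++u|∸k≡|r| r)) (drop-length-++ r u)

  inS⇔ : ∀ s → T (inS k ρ i s) ⇔ (∃ λ t → s ≡ t ∷ʳ a × T (inL ρ (suc (toℕ i)) t) × Suffix v t)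
  inS⇔ s = mk⇔ inS⇒ inS⇐
    where
    inS⇒ : T (inS k ρ i s) → ∃ λ t → s ≡ t ∷ʳ a × T (inL ρ (suc (toℕ i)) t) × Suffix v t
    inS⇒ h = r ++ v , trans s≡r++u (r++u≡r++v∷ʳa r) ,
             from T-avoidsAll (from avoids≤i⇔ (avoid<i , u⋢)) , r , refl
      where
      n = length s ∸ k
      r = take n s
      s≡r++u : s ≡ r ++ u
      s≡r++u = trans (sym (take++drop≡id n s))
        (cong (r ++_) (to T-==W (proj₁ (to T-∧ (proj₂ (to (T-∧ {k ≤ᵇ length s}) h))))))
      split = to (inS-r++u⇔ r) (subst (T ∘ inS k ρ i) s≡r++u h)
      u⋢ = proj₁ split
      avoid<i = avoids-infix ([] , [ a ] , r++u≡r++v∷ʳa r) (proj₂ split)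
    inS⇐ : (∃ λ t → s ≡ t ∷ʳ a × T (inL ρ (suc (toℕ i)) t) × Suffix v t) → T (inS k ρ i s)
    inS⇐ (_ , refl , ok , r , refl) =
      subst (T ∘ inS k ρ i) (r++u≡r++v∷ʳa r) (from (inS-r++u⇔ r) (u⋢ , avoids<i-r++u r avoid<i))
      where
      avoid<i = proj₁ (to avoids≤i⇔ (to T-avoidsAll ok))
      u⋢ = proj₂ (to avoids≤i⇔ (to T-avoidsAll ok))

  v-vertex : Vertex ρ≤i v
  v-vertex = Any.map (λ { refl → [ a ] , u≡va }) u∈ρ≤i

  run-to-v⇔ : ∀ t → run δ≤i [] t ≡ just v ⇔ (T (inL ρ (suc (toℕ i)) t) × Suffix v t)
  run-to-v⇔ t with avoids? ρ≤i t
  ... | yes avoid = mk⇔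
    (λ eq → from T-avoidsAll avoid ,
            subst (λ z → Suffix z t) (just-injective (trans (sym reached) eq))
                  (longestSuffixIn-suffix (isVertex ρ≤i) t))
    (λ { (_ , v⊒t) → trans reached (cong just (longestVertexSuffix-avoiding lengths≤i avoid v⊒t v-vertex
                                                 (trans 1+|v|≡|u| |u|≡k))) })
    where
    reached : run δ≤i [] t ≡ just (longestVertexSuffix ρ≤i t)
    reached = trans (run-canonDelta lengths≤i 0<k t) (stateAfter-avoiding avoid)
  ... | no reject = mk⇔ (λ eq → contradiction (trans (sym dies) eq) λ ())
                        (λ { (ok , _) → contradiction (to T-avoidsAll ok) reject })
    where
    dies : run δ≤i [] t ≡ nothing
    dies = trans (run-canonDelta lengths≤i 0<k t) (stateAfter-rejecting reject)

  inS-∷ʳa : ∀ t → inS k ρ i (t ∷ʳ a) ≡ acceptsFrom δ≤i [] (_==W v) t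
  inS-∷ʳa t = T⇔T⇒≡ (mk⇔
    (λ h → let t′ , eq , window = to (inS⇔ (t ∷ʳ a)) h in
           from (T-maybe-==W (run δ≤i [] t))
                (from (run-to-v⇔ t) (subst Window (sym (∷ʳ-injectiveˡ t t′ eq)) window)))
    (λ h → from (inS⇔ (t ∷ʳ a)) (t , refl , to (run-to-v⇔ t) (to (T-maybe-==W (run δ≤i [] t)) h))))
    where
    Window : Word σ → Set
    Window t = T (inL ρ (suc (toℕ i)) t) × Suffix v t

  count-S : ∀ m → count (inS k ρ i) (suc m) ≡ walksFromTo δ≤i m [] v
  count-S m = begin
    count (inS k ρ i) (suc m)
      ≡⟨ count-suffix (inS k ρ i) a m (λ s h → let t , eq , _ = to (inS⇔ s) h in t , eq) ⟩
    count (λ t → inS k ρ i (t ∷ʳ a)) m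
      ≡⟨ count-cong m (λ t _ → inS-∷ʳa t) ⟩
    count (acceptsFrom δ≤i [] (_==W v)) m
      ≡⟨ walksFromTo-count δ≤i m [] v ⟨
    walksFromTo δ≤i m [] v ∎
    where open ≡-Reasoning

  count-S-empty : count (inS k ρ i) 0 ≡ 0
  count-S-empty = count-none {L = inS k ρ i} 0 λ { [] _ h →
    let t , eq , _ = to (inS⇔ []) h in contradiction (++-conicalʳ t [ a ] (sym eq)) λ () }

  regular-S : Regular (inS k ρ i)
  regular-S = Regular-⇔ accepts⇔ (Automaton-regular (thenLetter A a dead))
    where
    A = canonicalAutomaton ρ≤i [] (here refl) (_==W v)
    dead : ∀ {x} → T (x ==W v) → canonDelta ρ≤i x a ≡ nothing
    dead x==v = subst (λ x → canonDelta ρ≤i x a ≡ nothing) (sym (to T-==W x==v))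
                      (canonDelta-dead ρ≤i (subst (_∈ ρ≤i) u≡va u∈ρ≤i))
    A≡ : ∀ t → Automaton.accepts A t ≡ inS k ρ i (t ∷ʳ a)
    A≡ t = trans (accepts-canonical ρ≤i [] _ _ t) (sym (inS-∷ʳa t))
    accepts⇔ : ∀ s → T (Automaton.accepts (thenLetter A a dead) s) ⇔ T (inS k ρ i s)
    accepts⇔ s = mk⇔
      (λ acc → let t , eq , t-acc = to (accepts-thenLetter A a dead s) acc in
               subst (T ∘ inS k ρ i) (sym eq) (subst T (A≡ t) t-acc))
      (λ h → let t , eq , _ = to (inS⇔ s) h in
             from (accepts-thenLetter A a dead s)
                  (t , eq , subst T (sym (A≡ t)) (subst (T ∘ inS k ρ i) eq h)))

lemma8 : (σ k : ℕ) → 2 ≤ σ → 2 ≤ k →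
  (ρ : List (Word σ)) → InU σ k ρ →
  (i : Fin (length ρ)) → (v : Word σ) → (a : Fin σ) →
  lookup ρ i ≡ v ++ [ a ] →
  -- (i)
  (((s : Word σ) →
      T (inP k ρ i s) ⇔ ((∃ λ t → s ≡ lookup ρ i ++ t) × T (inL ρ (toℕ i) s)))
   × ((s : Word σ) →
      T (inS k ρ i s) ⇔
        (∃ λ t → s ≡ t ++ [ a ] × T (inL ρ (suc (toℕ i)) t) × ∃ λ t′ → t ≡ t′ ++ v))
   × Regular (inP k ρ i) × Regular (inS k ρ i))
  -- (ii)
  × (∃ λ q → run (deltaA ρ (toℕ i)) [] (lookup ρ i) ≡ just q
       × ((m : ℕ) → count (inP k ρ i) (m + k) ≡ walksFrom (deltaA ρ (toℕ i)) m q)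
       × ((n : ℕ) → n < k → count (inP k ρ i) n ≡ 0))
  -- (iii)
  × (((m : ℕ) → count (inS k ρ i) (suc m) ≡ walksFromTo (deltaA ρ (suc (toℕ i))) m [] v)
     × count (inS k ρ i) 0 ≡ 0)
lemma8 σ k _ _ ρ ((lengths , unique) , _) i v a u≡va =
  (inP⇔ , inS⇔ , regular-P , regular-S) , (q , run-u , count-P , count-P-short) , (count-S , count-S-empty)
  where open Window ρ lengths unique i u≡va
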